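{- Let $X=\{x_0,\dots,x_{q-1}\}$, $Y=\{y_0,\dots,y_{q-1}\}$, $Z=\{z_0,\dots,z_{q-1}\}$. A lower triangular tensor $T$ over $X,Y,Z$ satisfies $\tilde I(T)=q$ if and only if it has $q$ diagonal terms, no two of which share a $z$-variable.
   Context: A tensor over $X,Y,Z$ (over a field) is a trilinear form $\sum T_{ijk}x_iy_jz_k$; terms are those with nonzero coefficient. $T$ is lower triangular if (i) for every $i,j\in\{0,\dots,q-1\}$ there is at most one $k$ with $x_iy_jz_k\in T$, and (ii) for every $i,j$ with $i+j\geq q$, $x_iy_jz_k\notin T$ for every $k$. Diagonal terms are the terms $x_iy_jz_k\in T$ with $i+j=q-1$. $T^{\otimes n}$ is the $n$-fold Kronecker tensor power; a zeroing out keeps only terms whose variables lie in chosen subsets of the variable sets; an independent tensor of size $r$ has support of $r$ terms pairwise sharing no variable; $I(T)$ is the largest size of an independent zeroing out of $T$ and $\tilde I(T)=\limsup_nI(T^{\otimes n})^{1/n}$. -}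

module Defs where

open import Level using (Level; _⊔_; suc)
open import Algebra.Bundles using (CommutativeRing)
open import Data.Nat using (ℕ; zero; _+_; _∸_; _<_; _≤_; _^_)
import Data.Nat
open import Data.Fin using (Fin; toℕ)
open import Data.Vec using (Vec; []; _∷_)
open import Data.List using (List; length)
open import Data.List.Membership.Propositional using (_∈_)
open import Data.List.Relation.Unary.AllPairs using (AllPairs)
open import Data.Product using (Σ; ∃; ∃-syntax; _×_; _,_)
open import Relation.Nullary using (¬_)
open import Relation.Binary.PropositionalEquality using (_≡_; _≢_)
open import Function.Bundles using (_⇔_)

record Field (c ℓ : Level) : Set (Level.suc (c ⊔ ℓ)) where
  field
    commutativeRing : CommutativeRing c ℓ
  open CommutativeRing commutativeRing public
  field
    0≉1     : ¬ (0# ≈ 1#)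
    inverse : ∀ x → ¬ (x ≈ 0#) → Σ Carrier λ y → (x * y) ≈ 1#

module _ {c ℓ : Level} (F : Field c ℓ) where
  open Field F using (Carrier; _≈_; 0#; 1#; _*_)

  Tensor : ℕ → Set c
  Tensor q = Fin q → Fin q → Fin q → Carrier

  IsTerm : ∀ {q} → Tensor q → Fin q → Fin q → Fin q → Set ℓ
  IsTerm T i j k = ¬ (T i j k ≈ 0#)

  LowerTriangular : ∀ q → Tensor q → Set ℓ
  LowerTriangular q T =
    (∀ i j k k′ → IsTerm T i j k → IsTerm T i j k′ → k ≡ k′)
    × (∀ i j k → q ≤ toℕ i + toℕ j → ¬ IsTerm T i j k)

  IsDiagonalTerm : ∀ q → Tensor q → Fin q × Fin q × Fin q → Set ℓ
  IsDiagonalTerm q T (i , j , k) = (toℕ i + toℕ j ≡ q ∸ 1) × IsTerm T i j k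

  QDiagonalDistinctZ : ∀ q → Tensor q → Set ℓ
  QDiagonalDistinctZ q T =
    (Σ (List (Fin q × Fin q × Fin q)) λ L →
        length L ≡ q
      × AllPairs _≢_ L
      × (∀ t → (t ∈ L) ⇔ IsDiagonalTerm q T t))
    × (∀ i j k i′ j′ k′ → IsDiagonalTerm q T (i , j , k) → IsDiagonalTerm q T (i′ , j′ , k′)
         → ¬ ((i , j , k) ≡ (i′ , j′ , k′)) → k ≢ k′)

  -- Variables of T^{⊗n}: x_{(i_1..i_n)} etc., indexed by Vec (Fin q) n.
  -- Coefficients of the Kronecker power T^{⊗n}.
  power : ∀ {q} → Tensor q → ∀ n → Vec (Fin q) n → Vec (Fin q) n → Vec (Fin q) n → Carrier
  power T zero [] [] [] = 1#
  power T (Data.Nat.suc n) (i ∷ is) (j ∷ js) (k ∷ ks) = T i j k * power T n is js ks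

  Idx : ℕ → ℕ → Set
  Idx q n = Vec (Fin q) n × Vec (Fin q) n × Vec (Fin q) n

  InZeroedSupport : ∀ {q} → Tensor q → ∀ n → (A B C : Vec (Fin q) n → Set) → Idx q n → Set ℓ
  InZeroedSupport T n A B C (x , y , z) = ¬ (power T n x y z ≈ 0#) × A x × B y × C z

  Disjoint : ∀ {q n} → Idx q n → Idx q n → Set
  Disjoint (x , y , z) (x′ , y′ , z′) = x ≢ x′ × y ≢ y′ × z ≢ z′

  HasIndependentZeroingOut : ∀ {q} → Tensor q → ℕ → ℕ → Set (Level.suc Level.zero ⊔ ℓ)
  HasIndependentZeroingOut {q} T n r =
    ∃[ A ] ∃[ B ] ∃[ C ] Σ (List (Idx q n)) λ L →
        length L ≡ r
      × AllPairs Disjoint L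
      × (∀ t → (t ∈ L) ⇔ InZeroedSupport T n A B C t)

  -- Ĩ(T) = limsup_n I(T^{⊗n})^{1/n} equals the natural number m, expressed
  -- with rational thresholds a/(b+1) (the values I(T^{⊗n})^{1/n} are ≥ 0):
  --  * limsup ≥ m : for each rational r < m, infinitely often I(T^{⊗n}) > r^n;
  --  * limsup ≤ m : for each rational r > m, eventually I(T^{⊗n}) < r^n.
  AsymptoticIndependenceEq : ∀ {q} → Tensor q → ℕ → Set (Level.suc Level.zero ⊔ ℓ)
  AsymptoticIndependenceEq T m =
    (∀ a b → a < m Data.Nat.* Data.Nat.suc b → ∀ N → ∃[ n ] (N ≤ n ×
        ∃[ s ] (HasIndependentZeroingOut T n s × a ^ n < s Data.Nat.* (Data.Nat.suc b ^ n))))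
    × (∀ a b → m Data.Nat.* Data.Nat.suc b < a → ∃[ N ] ∀ n → N ≤ n → ∀ s →
        HasIndependentZeroingOut T n s → s Data.Nat.* (Data.Nat.suc b ^ n) < a ^ n)

-- (⇒) Weights α, β, γ : Fin q → ℕ on the three variable sets, each of total less than q H, under
-- which every term x_i y_j z_k of T is heavy (α i + β j + γ k > 3 H) bound every independent
-- zeroing out of T^{⊗n}: after shifting the weights by a large K, a heavy term of T^{⊗n} has a
-- coordinate of product weight at least (K + H)ⁿ, while the weights of pairwise distinct
-- coordinates sum to at most (q (K + H) - 1)ⁿ; hence Ĩ(T) < q. If some diagonal position
-- (i, q - 1 - i) carried no term, or two diagonal terms shared a z-variable, such weights exist.
-- (⇐) If x_i y_{q-1-i} z_{σ(i)} are terms with σ injective, zeroing out T^{⊗n} to the x of digit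
-- sum c and the y of digit sum n (q - 1) - c leaves only products of these diagonal terms, which
-- are independent; some c keeps at least qⁿ / (n (q - 1) + 1) of them. Conversely an independent
-- set in T^{⊗n} has distinct x-variables, so at most qⁿ elements.

module Submission where

open import Defs
open import Level using (Level; _⊔_)
open import Data.Empty using (⊥; ⊥-elim)
open import Data.Fin as Fin using (Fin; zero; suc; toℕ; opposite; fromℕ<)
open import Data.Fin.Properties using (toℕ-injective; toℕ<n; toℕ-fromℕ<; opposite-prop; opposite-involutive)
open import Data.List as List using (List; []; _∷_; _++_; map; concat; concatMap; length; tabulate; allFin; filter)
open import Data.List.Membership.Propositional using (_∈_; _─_)
open import Data.List.Membership.Propositional.Properties
  using (∈-map⁺; ∈-map⁻; ∈-allFin; ∈-concatMap⁺; ∈-filter⁺; ∈-filter⁻)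
open import Data.List.Properties using (length-map; length-tabulate)
open import Data.List.Relation.Binary.Disjoint.Propositional using () renaming (Disjoint to Disjointₗ)
open import Data.List.Relation.Binary.Subset.Propositional using (_⊆_)
open import Data.List.Relation.Unary.All as All using (All; []; _∷_)
import Data.List.Relation.Unary.All.Properties as All
open import Data.List.Relation.Unary.AllPairs as AllPairs using (AllPairs; []; _∷_)
import Data.List.Relation.Unary.AllPairs.Properties as AllPairs
open import Data.List.Relation.Unary.Any as Any using (here; there)
open import Data.List.Relation.Unary.Unique.Propositional using (Unique)
import Data.List.Relation.Unary.Unique.Propositional.Properties as Unique
open import Data.Nat using (ℕ; zero; suc; _+_; _*_; _∸_; _^_; _≤_; _<_; _≤?_; _<?_; z≤n; s≤s; pred; NonZero; >-nonZero)
open import Data.Nat.Properties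
open import Algebra.Properties.CommutativeSemigroup +-commutativeSemigroup
  using () renaming (interchange to +-interchange; x∙yz≈y∙xz to x+[y+z]≡y+[x+z])
open import Data.Nat.Tactic.RingSolver using (solve-∀)
open import Data.Product using (Σ; ∃-syntax; _×_; _,_; proj₁; proj₂)
open import Data.Sum as Sum using (_⊎_; inj₁; inj₂; [_,_]′)
open import Data.Unit using (⊤; tt)
open import Data.Vec as Vec using (Vec; []; _∷_)
open import Data.Vec.Properties using (∷-injectiveˡ; ∷-injectiveʳ)
open import Function using (_∘_)
open import Function.Bundles using (_⇔_; mk⇔; Equivalence)
open import Relation.Binary.Definitions using (tri<; tri≈; tri>)
open import Relation.Binary.PropositionalEquality
  using (_≡_; _≢_; refl; sym; trans; cong; cong₂; subst; subst₂; module ≡-Reasoning)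
open import Relation.Nullary using (¬_; Dec; yes; no)

private variable
  A B : Set
  n q : ℕ

sumBy : (A → ℕ) → List A → ℕ
sumBy f []       = 0
sumBy f (x ∷ xs) = f x + sumBy f xs

sumBy-++ : (f : A → ℕ) (xs ys : List A) → sumBy f (xs ++ ys) ≡ sumBy f xs + sumBy f ys
sumBy-++ f []       ys = refl
sumBy-++ f (x ∷ xs) ys = trans (cong (f x +_) (sumBy-++ f xs ys)) (sym (+-assoc (f x) _ _))

sumBy-map : (f : B → ℕ) (g : A → B) (xs : List A) → sumBy f (map g xs) ≡ sumBy (f ∘ g) xs
sumBy-map f g []       = refl
sumBy-map f g (x ∷ xs) = cong (f (g x) +_) (sumBy-map f g xs)

sumBy-concat : (f : A → ℕ) (xss : List (List A)) → sumBy f (concat xss) ≡ sumBy (sumBy f) xss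
sumBy-concat f []         = refl
sumBy-concat f (xs ∷ xss) = trans (sumBy-++ f xs (concat xss)) (cong (sumBy f xs +_) (sumBy-concat f xss))

sumBy-*ˡ : (c : ℕ) (f : A → ℕ) (xs : List A) → sumBy (λ x → c * f x) xs ≡ c * sumBy f xs
sumBy-*ˡ c f []       = sym (*-zeroʳ c)
sumBy-*ˡ c f (x ∷ xs) = trans (cong (c * f x +_) (sumBy-*ˡ c f xs)) (sym (*-distribˡ-+ c (f x) _))

sumBy-+ : (f g : A → ℕ) (xs : List A) → sumBy (λ x → f x + g x) xs ≡ sumBy f xs + sumBy g xs
sumBy-+ f g []       = refl
sumBy-+ f g (x ∷ xs) = trans (cong (f x + g x +_) (sumBy-+ f g xs)) (+-interchange (f x) (g x) _ _)

sumBy-const : (c : ℕ) (xs : List A) → sumBy (λ _ → c) xs ≡ length xs * c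
sumBy-const c []       = refl
sumBy-const c (x ∷ xs) = cong (c +_) (sumBy-const c xs)

sumBy-one : (xs : List A) → sumBy (λ _ → 1) xs ≡ length xs
sumBy-one xs = trans (sumBy-const 1 xs) (*-identityʳ (length xs))

sumBy-cong : {f g : A → ℕ} (xs : List A) → (∀ x → f x ≡ g x) → sumBy f xs ≡ sumBy g xs
sumBy-cong []       f≗g = refl
sumBy-cong (x ∷ xs) f≗g = cong₂ _+_ (f≗g x) (sumBy-cong xs f≗g)

sumBy-mono : (f g : A → ℕ) (xs : List A) → (∀ {x} → x ∈ xs → f x ≤ g x) → sumBy f xs ≤ sumBy g xs
sumBy-mono f g []       f≤g = z≤n
sumBy-mono f g (x ∷ xs) f≤g = +-mono-≤ (f≤g (here refl)) (sumBy-mono f g xs (f≤g ∘ there))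

sumBy-─ : (f : A → ℕ) {x : A} {xs : List A} (x∈xs : x ∈ xs) → sumBy f xs ≡ f x + sumBy f (xs ─ x∈xs)
sumBy-─ f           (here refl)   = refl
sumBy-─ f {x} {y ∷ xs} (there x∈xs) =
  trans (cong (f y +_) (sumBy-─ f x∈xs)) (x+[y+z]≡y+[x+z] (f y) (f x) _)

∈-─ : {x y : A} {xs : List A} (x∈xs : x ∈ xs) → y ∈ xs → y ≢ x → y ∈ xs ─ x∈xs
∈-─ (here refl) (here refl)  y≢x = ⊥-elim (y≢x refl)
∈-─ (here refl) (there y∈xs) y≢x = y∈xs
∈-─ (there x∈xs) (here refl)  y≢x = here refl
∈-─ (there x∈xs) (there y∈xs) y≢x = there (∈-─ x∈xs y∈xs y≢x)

length-─ : {x : A} {xs : List A} (x∈xs : x ∈ xs) → suc (length (xs ─ x∈xs)) ≡ length xs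
length-─ {xs = xs} x∈xs = trans (cong suc (sym (sumBy-one (xs ─ x∈xs)))) (trans (sym (sumBy-─ (λ _ → 1) x∈xs)) (sumBy-one xs))

sumBy-mono-⊆ : (f : A → ℕ) {xs ys : List A} → Unique xs → xs ⊆ ys → sumBy f xs ≤ sumBy f ys
sumBy-mono-⊆ f {[]}     _               _     = z≤n
sumBy-mono-⊆ f {x ∷ xs} (x∉xs ∷ xs-uniq) xs⊆ys =
  subst (f x + sumBy f xs ≤_) (sym (sumBy-─ f (xs⊆ys (here refl))))
    (+-monoʳ-≤ (f x) (sumBy-mono-⊆ f xs-uniq
      (λ y∈xs → ∈-─ (xs⊆ys (here refl)) (xs⊆ys (there y∈xs)) (All.lookup x∉xs y∈xs ∘ sym))))

AllPairs-mapWithAll : ∀ {p r s} {P : A → Set p} {R : A → A → Set r} {S : A → A → Set s} →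
  (∀ {x y} → P x → P y → R x y → S x y) → ∀ {xs} → All P xs → AllPairs R xs → AllPairs S xs
AllPairs-mapWithAll f []         []         = []
AllPairs-mapWithAll f (px ∷ pxs) (rx ∷ rxs) =
  All.zipWith (λ (py , r) → f px py r) (pxs , rx) ∷ AllPairs-mapWithAll f pxs rxs

length-mono-⊆ : {xs ys : List A} → Unique xs → xs ⊆ ys → length xs ≤ length ys
length-mono-⊆ {xs = xs} {ys} xs-uniq xs⊆ys =
  subst₂ _≤_ (sumBy-one xs) (sumBy-one ys) (sumBy-mono-⊆ (λ _ → 1) xs-uniq xs⊆ys)

∑ : ∀ n → (Fin n → ℕ) → ℕ
∑ zero    f = 0
∑ (suc n) f = f zero + ∑ n (f ∘ suc)

sumBy-tabulate : (f : A → ℕ) (g : Fin n → A) → sumBy f (tabulate g) ≡ ∑ n (f ∘ g)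
sumBy-tabulate {n = zero}  f g = refl
sumBy-tabulate {n = suc n} f g = cong (f (g zero) +_) (sumBy-tabulate f (g ∘ suc))

∑-cong : ∀ n {f g : Fin n → ℕ} → (∀ i → f i ≡ g i) → ∑ n f ≡ ∑ n g
∑-cong zero    f≗g = refl
∑-cong (suc n) f≗g = cong₂ _+_ (f≗g zero) (∑-cong n (f≗g ∘ suc))

∑-+ : ∀ n (f g : Fin n → ℕ) → ∑ n (λ i → f i + g i) ≡ ∑ n f + ∑ n g
∑-+ zero    f g = refl
∑-+ (suc n) f g = trans (cong (f zero + g zero +_) (∑-+ n (f ∘ suc) (g ∘ suc))) (+-interchange (f zero) (g zero) _ _)

∑-*ʳ : ∀ n (f : Fin n → ℕ) (c : ℕ) → ∑ n (λ i → f i * c) ≡ ∑ n f * c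
∑-*ʳ zero    f c = refl
∑-*ʳ (suc n) f c = trans (cong (f zero * c +_) (∑-*ʳ n (f ∘ suc) c)) (sym (*-distribʳ-+ c (f zero) _))

∑-const : ∀ n (c : ℕ) → ∑ n (λ _ → c) ≡ n * c
∑-const zero    c = refl
∑-const (suc n) c = cong (c +_) (∑-const n c)

onlyAt : Fin q → ℕ → ℕ → Fin q → ℕ
onlyAt zero     X Y zero    = X
onlyAt zero     X Y (suc i) = Y
onlyAt (suc i₀) X Y zero    = Y
onlyAt (suc i₀) X Y (suc i) = onlyAt i₀ X Y i

onlyAt-≡ : (i : Fin q) (X Y : ℕ) → onlyAt i X Y i ≡ X
onlyAt-≡ zero    X Y = refl
onlyAt-≡ (suc i) X Y = onlyAt-≡ i X Y

onlyAt-≢ : {i₀ i : Fin q} (X Y : ℕ) → i₀ ≢ i → onlyAt i₀ X Y i ≡ Y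
onlyAt-≢ {i₀ = zero}   {zero}  X Y i₀≢i = ⊥-elim (i₀≢i refl)
onlyAt-≢ {i₀ = zero}   {suc i} X Y i₀≢i = refl
onlyAt-≢ {i₀ = suc i₀} {zero}  X Y i₀≢i = refl
onlyAt-≢ {i₀ = suc i₀} {suc i} X Y i₀≢i = onlyAt-≢ X Y (i₀≢i ∘ cong suc)

onlyAt-≥ : (i₀ i : Fin q) {m X Y : ℕ} → m ≤ X → m ≤ Y → m ≤ onlyAt i₀ X Y i
onlyAt-≥ zero     zero    m≤X m≤Y = m≤X
onlyAt-≥ zero     (suc i) m≤X m≤Y = m≤Y
onlyAt-≥ (suc i₀) zero    m≤X m≤Y = m≤Y
onlyAt-≥ (suc i₀) (suc i) m≤X m≤Y = onlyAt-≥ i₀ i m≤X m≤Y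

∑-onlyAt : ∀ n (i₀ : Fin (suc n)) (X Y : ℕ) → ∑ (suc n) (onlyAt i₀ X Y) ≡ X + n * Y
∑-onlyAt n       zero     X Y = cong (X +_) (∑-const n Y)
∑-onlyAt (suc n) (suc i₀) X Y = trans (cong (Y +_) (∑-onlyAt n i₀ X Y)) (x+[y+z]≡y+[x+z] Y X (n * Y))

pigeonhole : ∀ n (f : Fin (suc n) → ℕ) → ∃[ i ] ∑ (suc n) f ≤ suc n * f i
pigeonhole zero    f = zero , ≤-refl
pigeonhole (suc n) f with pigeonhole n (f ∘ suc)
... | i , ∑≤ with f zero ≤? f (suc i)
...   | yes f₀≤fᵢ = suc i , +-mono-≤ f₀≤fᵢ ∑≤
...   | no  f₀≰fᵢ = zero , +-monoʳ-≤ (f zero) (≤-trans ∑≤ (*-monoʳ-≤ (suc n) (<⇒≤ (≰⇒> f₀≰fᵢ))))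

∑-indicator : ∀ {n} (i₀ : Fin n) → ∑ n (onlyAt i₀ 1 0) ≡ 1
∑-indicator {suc n} i₀ = trans (∑-onlyAt n i₀ 1 0) (cong suc (*-zeroʳ n))

module _ {m : ℕ} (class : A → Fin m) where

  inClass? : (c : Fin m) (x : A) → Dec (class x ≡ c)
  inClass? c x = class x Fin.≟ c

  length-filter-∷ : (c : Fin m) (x : A) (xs : List A) →
    length (filter (inClass? c) (x ∷ xs)) ≡ onlyAt (class x) 1 0 c + length (filter (inClass? c) xs)
  length-filter-∷ c x xs with class x Fin.≟ c
  ... | yes refl = sym (cong (_+ length (filter (inClass? (class x)) xs)) (onlyAt-≡ (class x) 1 0))
  ... | no  x∉c  = sym (cong (_+ length (filter (inClass? c) xs)) (onlyAt-≢ 1 0 x∉c))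

  ∑-length-filter : (xs : List A) → ∑ m (λ c → length (filter (inClass? c) xs)) ≡ length xs
  ∑-length-filter []       = trans (∑-const m 0) (*-zeroʳ m)
  ∑-length-filter (x ∷ xs) = begin
    ∑ m (λ c → length (filter (inClass? c) (x ∷ xs)))                 ≡⟨ ∑-cong m (λ c → length-filter-∷ c x xs) ⟩
    ∑ m (λ c → onlyAt (class x) 1 0 c + length (filter (inClass? c) xs)) ≡⟨ ∑-+ m _ _ ⟩
    ∑ m (onlyAt (class x) 1 0) + ∑ m (λ c → length (filter (inClass? c) xs))
      ≡⟨ cong₂ _+_ (∑-indicator (class x)) (∑-length-filter xs) ⟩
    suc (length xs)                                                    ∎
    where open ≡-Reasoning

below : ℕ → ℕ → ℕ → ℕ → ℕ
below zero    X Y m       = Y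
below (suc a) X Y zero    = X
below (suc a) X Y (suc m) = below a X Y m

below-< : ∀ {a X Y m} → m < a → below a X Y m ≡ X
below-< {suc a} {m = zero}  _         = refl
below-< {suc a} {m = suc m} (s≤s m<a) = below-< m<a

below-≥ : ∀ {a X Y m} → a ≤ m → below a X Y m ≡ Y
below-≥ {zero}              _         = refl
below-≥ {suc a} {m = suc m} (s≤s a≤m) = below-≥ a≤m

∑-below : ∀ a q X Y → a ≤ q → ∑ q (λ i → below a X Y (toℕ i)) ≡ a * X + (q ∸ a) * Y
∑-below zero    q       X Y _         = ∑-const q Y
∑-below (suc a) (suc q) X Y (s≤s a≤q) = trans (cong (X +_) (∑-below a q X Y a≤q)) (sym (+-assoc X (a * X) _))

∑-countdown : ∀ c → 2 * ∑ (suc c) (λ i → c ∸ toℕ i) ≡ c * suc c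
∑-countdown zero    = refl
∑-countdown (suc c) = begin
  2 * (suc c + ∑ (suc c) (λ i → c ∸ toℕ i))   ≡⟨ *-distribˡ-+ 2 (suc c) _ ⟩
  2 * suc c + 2 * ∑ (suc c) (λ i → c ∸ toℕ i) ≡⟨ cong (2 * suc c +_) (∑-countdown c) ⟩
  2 * suc c + c * suc c                       ≡⟨ *-distribʳ-+ (suc c) 2 c ⟨
  suc (suc c) * suc c                         ≡⟨ *-comm (suc (suc c)) (suc c) ⟩
  suc c * suc (suc c)                         ∎
  where open ≡-Reasoning

vecs : ∀ q n → List (Vec (Fin q) n)
vecs q zero    = [] ∷ []
vecs q (suc n) = concatMap (λ i → map (i ∷_) (vecs q n)) (allFin q)

∈-vecs : (v : Vec (Fin q) n) → v ∈ vecs q n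
∈-vecs []      = here refl
∈-vecs (i ∷ v) = ∈-concatMap⁺ _ (Any.map (λ { refl → ∈-map⁺ (i ∷_) (∈-vecs v) }) (∈-allFin i))

vecs-unique : ∀ q n → Unique (vecs q n)
vecs-unique q zero    = [] ∷ []
vecs-unique q (suc n) = Unique.concat⁺
  (All.map⁺ (All.universal (λ i → Unique.map⁺ ∷-injectiveʳ (vecs-unique q n)) (allFin q)))
  (AllPairs.map⁺ (AllPairs.tabulate⁺ blocks-disjoint))
  where
  head-of-block : ∀ {i : Fin q} {v} → v ∈ map (i ∷_) (vecs q n) → Vec.head v ≡ i
  head-of-block v∈ with _ , _ , refl ← ∈-map⁻ (_ ∷_) v∈ = refl
  blocks-disjoint : ∀ {i j} → i ≢ j → Disjointₗ (map (i ∷_) (vecs q n)) (map (j ∷_) (vecs q n))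
  blocks-disjoint i≢j (v∈i , v∈j) = i≢j (trans (sym (head-of-block v∈i)) (head-of-block v∈j))

weight : (Fin q → ℕ) → Vec (Fin q) n → ℕ
weight a []      = 1
weight a (i ∷ v) = a i * weight a v

sumBy-weight-vecs : ∀ q n (a : Fin q → ℕ) → sumBy (weight a) (vecs q n) ≡ ∑ q a ^ n
sumBy-weight-vecs q zero    a = refl
sumBy-weight-vecs q (suc n) a = begin
  sumBy (weight a) (concatMap block (allFin q))           ≡⟨ sumBy-concat (weight a) (map block (allFin q)) ⟩
  sumBy (sumBy (weight a)) (map block (allFin q))         ≡⟨ sumBy-map (sumBy (weight a)) block (allFin q) ⟩
  sumBy (sumBy (weight a) ∘ block) (allFin q)             ≡⟨ sumBy-tabulate (sumBy (weight a) ∘ block) (λ i → i) ⟩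
  ∑ q (sumBy (weight a) ∘ block)                          ≡⟨ ∑-cong q block-sum ⟩
  ∑ q (λ i → a i * ∑ q a ^ n)                             ≡⟨ ∑-*ʳ q a (∑ q a ^ n) ⟩
  ∑ q a ^ suc n                                           ∎
  where
  open ≡-Reasoning
  block : Fin q → List (Vec (Fin q) (suc n))
  block i = map (i ∷_) (vecs q n)
  block-sum : ∀ i → sumBy (weight a) (block i) ≡ a i * ∑ q a ^ n
  block-sum i = trans (sumBy-map (weight a) (i ∷_) (vecs q n))
                  (trans (sumBy-*ˡ (a i) (weight a) (vecs q n)) (cong (a i *_) (sumBy-weight-vecs q n a)))

weight-one : (v : Vec (Fin q) n) → weight (λ _ → 1) v ≡ 1
weight-one []      = refl
weight-one (i ∷ v) = trans (+-identityʳ _) (weight-one v)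

length-vecs : ∀ q n → length (vecs q n) ≡ q ^ n
length-vecs q n = begin
  length (vecs q n)                         ≡⟨ sumBy-one (vecs q n) ⟨
  sumBy (λ _ → 1) (vecs q n)                ≡⟨ sumBy-cong (vecs q n) (λ v → sym (weight-one v)) ⟩
  sumBy (weight (λ _ → 1)) (vecs q n)       ≡⟨ sumBy-weight-vecs q n (λ _ → 1) ⟩
  ∑ q (λ _ → 1) ^ n                         ≡⟨ cong (_^ n) (trans (∑-const q 1) (*-identityʳ q)) ⟩
  q ^ n                                     ∎
  where open ≡-Reasoning

sumBy-weight-≤ : (a : Fin q → ℕ) (pr : A → Vec (Fin q) n) {xs : List A} →
  AllPairs (λ x y → pr x ≢ pr y) xs → sumBy (weight a ∘ pr) xs ≤ ∑ q a ^ n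
sumBy-weight-≤ {q = q} {n = n} a pr {xs} pr-distinct = begin
  sumBy (weight a ∘ pr) xs        ≡⟨ sumBy-map (weight a) pr xs ⟨
  sumBy (weight a) (map pr xs)    ≤⟨ sumBy-mono-⊆ (weight a) (AllPairs.map⁺ pr-distinct) (λ _ → ∈-vecs _) ⟩
  sumBy (weight a) (vecs q n)     ≡⟨ sumBy-weight-vecs q n a ⟩
  ∑ q a ^ n                       ∎
  where open ≤-Reasoning

map-injective : ∀ {A B : Set} {f : A → B} → (∀ {a b} → f a ≡ f b → a ≡ b) →
  ∀ {n} {u v : Vec A n} → Vec.map f u ≡ Vec.map f v → u ≡ v
map-injective f-inj {u = []}    {[]}    _ = refl
map-injective f-inj {u = a ∷ u} {b ∷ v} fu≡fv =
  cong₂ _∷_ (f-inj (∷-injectiveˡ fu≡fv)) (map-injective f-inj (∷-injectiveʳ fu≡fv))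

opposite-injective : ∀ {n} {i j : Fin n} → opposite i ≡ opposite j → i ≡ j
opposite-injective {i = i} {j} o≡o = trans (sym (opposite-involutive i)) (trans (cong opposite o≡o) (opposite-involutive j))

suc[i+opposite[i]]≡n : ∀ {n} (i : Fin n) → suc (toℕ i + toℕ (opposite i)) ≡ n
suc[i+opposite[i]]≡n i = trans (cong (λ o → suc (toℕ i + o)) (opposite-prop i)) (m+[n∸m]≡n (toℕ<n i))

i+opposite[i]≡n∸1 : ∀ {n} (i : Fin n) → toℕ i + toℕ (opposite i) ≡ n ∸ 1
i+opposite[i]≡n∸1 i = cong pred (suc[i+opposite[i]]≡n i)

i+j≡n∸1⇒j≡opposite[i] : ∀ {n} {i j : Fin n} → toℕ i + toℕ j ≡ n ∸ 1 → j ≡ opposite i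
i+j≡n∸1⇒j≡opposite[i] {i = i} {j} i+j≡n∸1 =
  toℕ-injective (+-cancelˡ-≡ (toℕ i) (toℕ j) _ (trans i+j≡n∸1 (sym (i+opposite[i]≡n∸1 i))))

digit-sum : ∀ {q n} → Vec (Fin q) n → ℕ
digit-sum []      = 0
digit-sum (i ∷ v) = toℕ i + digit-sum v

digit-sum-opposite : ∀ {q n} (v : Vec (Fin q) n) → digit-sum v + digit-sum (Vec.map opposite v) ≡ n * (q ∸ 1)
digit-sum-opposite []      = refl
digit-sum-opposite (i ∷ v) = trans (+-interchange (toℕ i) (digit-sum v) (toℕ (opposite i)) _)
                               (cong₂ _+_ (i+opposite[i]≡n∸1 i) (digit-sum-opposite v))

digit-sum-≤ : ∀ {q n} (v : Vec (Fin q) n) → digit-sum v ≤ n * (q ∸ 1)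
digit-sum-≤ v = subst (digit-sum v ≤_) (digit-sum-opposite v) (m≤m+n _ _)

+-squeeze : ∀ {a b c d} → a ≤ b → c ≤ d → a + c ≡ b + d → a ≡ b × c ≡ d
+-squeeze {a} {b} {c} {d} a≤b c≤d a+c≡b+d =
  ≤-antisym a≤b (+-cancelʳ-≤ c b a (≤-trans (+-monoʳ-≤ b c≤d) (≤-reflexive (sym a+c≡b+d)))) ,
  ≤-antisym c≤d (+-cancelˡ-≤ a d c (≤-trans (+-monoˡ-≤ d a≤b) (≤-reflexive (sym a+c≡b+d))))

^-distribʳ-* : ∀ m n k → (m * n) ^ k ≡ m ^ k * n ^ k
^-distribʳ-* m n zero    = refl
^-distribʳ-* m n (suc k) = trans (cong (m * n *_) (^-distribʳ-* m n k)) (interchange m n (m ^ k) (n ^ k))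
  where
  interchange : ∀ m n a b → m * n * (a * b) ≡ m * a * (n * b)
  interchange = solve-∀

m^3≡m*m*m : ∀ m → m ^ 3 ≡ m * m * m
m^3≡m*m*m m = trans (cong (λ t → m * (m * t)) (*-identityʳ m)) (sym (*-assoc m m m))

^3≤*⇒≤+ : ∀ M X Y Z → M ^ 3 ≤ X * Y * Z → M ≤ X + Y + Z
^3≤*⇒≤+ M X Y Z M³≤XYZ with M ≤? X + Y + Z
... | yes M≤S = M≤S
... | no  M≰S = ⊥-elim (<⇒≱ XYZ<M³ M³≤XYZ)
  where
  S<M : X + Y + Z < M
  S<M = ≰⇒> M≰S
  XYZ<M³ : X * Y * Z < M ^ 3
  XYZ<M³ = begin-strict
    X * Y * Z                          ≤⟨ *-mono-≤ (*-mono-≤ (≤-trans (m≤m+n X Y) (m≤m+n _ Z))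
                                                            (≤-trans (m≤n+m Y X) (m≤m+n _ Z)))
                                                  (m≤n+m Z (X + Y)) ⟩
    (X + Y + Z) * (X + Y + Z) * (X + Y + Z) <⟨ *-mono-< (*-mono-< S<M S<M) S<M ⟩
    M * M * M                          ≡⟨ m^3≡m*m*m M ⟨
    M ^ 3                              ∎
    where open ≤-Reasoning

-- A shift K large compared to c, so that the cubic terms in c of (K + c)³ are absorbed by K².
margin : ℕ → ℕ
margin c = suc (3 * c * c + c * c * c)

[K+c]^3≤[K+x][K+y][K+z] : ∀ c x y z → 3 * c + 1 ≤ x + y + z →
  let K = margin c in (K + c) ^ 3 ≤ (K + x) * (K + y) * (K + z)
[K+c]^3≤[K+x][K+y][K+z] c x y z 3c<x+y+z = begin
  (K + c) ^ 3                                                        ≡⟨ m^3≡m*m*m (K + c) ⟩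
  (K + c) * (K + c) * (K + c)                                        ≡⟨ expand-cube K c ⟩
  K * K * K + K * K * (3 * c) + (3 * c * c * K + c * c * c)         ≤⟨ +-monoʳ-≤ (K * K * K + K * K * (3 * c)) absorb ⟩
  K * K * K + K * K * (3 * c) + K * K                                ≡⟨ collect (K * K * K) (K * K) (3 * c) ⟩
  K * K * K + K * K * (3 * c + 1)                                    ≤⟨ +-monoʳ-≤ (K * K * K) (*-monoʳ-≤ (K * K) 3c<x+y+z) ⟩
  K * K * K + K * K * (x + y + z)                                    ≤⟨ m≤m+n _ _ ⟩
  K * K * K + K * K * (x + y + z) + (K * (x * y + y * z + z * x) + x * y * z) ≡⟨ expand-product K x y z ⟨
  (K + x) * (K + y) * (K + z)                                        ∎
  where
  open ≤-Reasoning
  K = margin c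
  absorb : 3 * c * c * K + c * c * c ≤ K * K
  absorb = begin
    3 * c * c * K + c * c * c              ≤⟨ +-monoʳ-≤ (3 * c * c * K) (m≤m*n (c * c * c) K) ⟩
    3 * c * c * K + c * c * c * K          ≡⟨ *-distribʳ-+ K (3 * c * c) (c * c * c) ⟨
    (3 * c * c + c * c * c) * K            ≤⟨ *-monoˡ-≤ K (n≤1+n (3 * c * c + c * c * c)) ⟩
    K * K                                  ∎
  expand-cube : ∀ K c → (K + c) * (K + c) * (K + c) ≡ K * K * K + K * K * (3 * c) + (3 * c * c * K + c * c * c)
  expand-cube = solve-∀
  collect : ∀ a b t → a + b * t + b ≡ a + b * (t + 1)
  collect = solve-∀
  expand-product : ∀ K x y z → (K + x) * (K + y) * (K + z)
    ≡ K * K * K + K * K * (x + y + z) + (K * (x * y + y * z + z * x) + x * y * z)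
  expand-product = solve-∀

-- Bernoulli's inequality (1 + 1/x)ⁿ ≥ 1 + n/x, cleared of denominators.
bernoulli : ∀ x n → x ^ n * (x + n) ≤ x * suc x ^ n
bernoulli x zero    = ≤-reflexive (solve x)
  where
  solve : ∀ x → 1 * (x + 0) ≡ x * 1
  solve = solve-∀
bernoulli x (suc n) = begin
  x * x ^ n * (x + suc n)               ≡⟨ split x (x ^ n) n ⟩
  x ^ n * (x + n) * x + x ^ n * x       ≤⟨ +-monoʳ-≤ (x ^ n * (x + n) * x) (*-monoʳ-≤ (x ^ n) (m≤m+n x n)) ⟩
  x ^ n * (x + n) * x + x ^ n * (x + n) ≡⟨ times-suc (x ^ n * (x + n)) x ⟨
  x ^ n * (x + n) * suc x               ≤⟨ *-monoˡ-≤ (suc x) (bernoulli x n) ⟩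
  x * suc x ^ n * suc x                 ≡⟨ reorder x (suc x ^ n) (suc x) ⟩
  x * (suc x * suc x ^ n)               ∎
  where
  open ≤-Reasoning
  split : ∀ x p n → x * p * (x + suc n) ≡ p * (x + n) * x + p * x
  split = solve-∀
  times-suc : ∀ p x → p * suc x ≡ p * x + p
  times-suc = solve-∀
  reorder : ∀ x p s → x * p * s ≡ x * (s * p)
  reorder = solve-∀

3*x^n≤[1+x]^n : ∀ x n → 1 ≤ x → 2 * x ≤ n → 3 * x ^ n ≤ suc x ^ n
3*x^n≤[1+x]^n x n 1≤x 2x≤n = *-cancelˡ-≤ x (begin
  x * (3 * x ^ n)      ≡⟨ reorder x (x ^ n) ⟩
  x ^ n * (x + 2 * x)  ≤⟨ *-monoʳ-≤ (x ^ n) (+-monoʳ-≤ x 2x≤n) ⟩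
  x ^ n * (x + n)      ≤⟨ bernoulli x n ⟩
  x * suc x ^ n        ∎)
  where
  open ≤-Reasoning
  instance
    x≢0 : NonZero x
    x≢0 = >-nonZero 1≤x
  reorder : ∀ x p → x * (3 * p) ≡ p * (x + 2 * x)
  reorder = solve-∀

-- Squaring Bernoulli: ((a + m)/a)² beats the linear factor 2mc + 1 once m ≥ a²(2c + 1).
[2mc+1]*a^2m<[1+a]^2m : ∀ a c m → 1 ≤ a → 1 ≤ m → a * a * (2 * c + 1) ≤ m →
  (2 * m * c + 1) * a ^ (2 * m) < suc a ^ (2 * m)
[2mc+1]*a^2m<[1+a]^2m a c m 1≤a 1≤m m-large = *-cancelˡ-< (a * a) _ _ (begin-strict
  a * a * ((2 * m * c + 1) * a ^ (2 * m))  ≡⟨ cong (λ w → a * a * ((2 * m * c + 1) * w)) (^-double a m) ⟩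
  a * a * ((2 * m * c + 1) * (aᵐ * aᵐ))    ≡⟨ reassoc a (2 * m * c + 1) aᵐ ⟩
  a * a * (2 * m * c + 1) * (aᵐ * aᵐ)      <⟨ *-monoˡ-< (aᵐ * aᵐ) linear<square ⟩
  (a + m) * (a + m) * (aᵐ * aᵐ)            ≡⟨ regroup (a + m) aᵐ ⟩
  aᵐ * (a + m) * (aᵐ * (a + m))            ≤⟨ *-mono-≤ (bernoulli a m) (bernoulli a m) ⟩
  a * suc a ^ m * (a * suc a ^ m)          ≡⟨ regroup′ a (suc a ^ m) ⟩
  a * a * (suc a ^ m * suc a ^ m)          ≡⟨ cong (a * a *_) (^-double (suc a) m) ⟨
  a * a * suc a ^ (2 * m)                  ∎)
  where
  open ≤-Reasoning
  aᵐ = a ^ m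
  instance
    aᵐaᵐ≢0 : NonZero (aᵐ * aᵐ)
    aᵐaᵐ≢0 = >-nonZero (*-mono-≤ (^-positive m 1≤a) (^-positive m 1≤a))
      where
      ^-positive : ∀ m → 1 ≤ a → 1 ≤ a ^ m
      ^-positive m 1≤a = subst (_≤ a ^ m) (^-zeroˡ m) (^-monoˡ-≤ m 1≤a)
  ^-double : ∀ a m → a ^ (2 * m) ≡ a ^ m * a ^ m
  ^-double a m = trans (cong (λ k → a ^ (m + k)) (+-identityʳ m)) (^-distribˡ-+-* a m m)
  linear<square : a * a * (2 * m * c + 1) < (a + m) * (a + m)
  linear<square = begin-strict
    a * a * (2 * m * c + 1)  ≤⟨ *-monoʳ-≤ (a * a) (+-monoʳ-≤ (2 * m * c) 1≤m) ⟩
    a * a * (2 * m * c + m)  ≡⟨ factor a m c ⟩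
    a * a * (2 * c + 1) * m  ≤⟨ *-monoˡ-≤ m m-large ⟩
    m * m                    <⟨ *-mono-< (m<n+m m 1≤a) (m<n+m m 1≤a) ⟩
    (a + m) * (a + m)        ∎
    where
    factor : ∀ a m c → a * a * (2 * m * c + m) ≡ a * a * (2 * c + 1) * m
    factor = solve-∀
  reassoc : ∀ a t y → a * a * (t * (y * y)) ≡ a * a * t * (y * y)
  reassoc = solve-∀
  regroup : ∀ s y → s * s * (y * y) ≡ y * s * (y * s)
  regroup = solve-∀
  regroup′ : ∀ a b → a * b * (a * b) ≡ a * a * (b * b)
  regroup′ = solve-∀

exp-beats-linear : ∀ a y c N → a < y → ∃[ n ] (N ≤ n × (n * c + 1) * a ^ n < y ^ n)
exp-beats-linear zero y c N 0<y =
  suc N , n≤1+n N ,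
  subst (_< y ^ suc N) (sym (*-zeroʳ (suc N * c + 1)))
    (subst (_≤ y ^ suc N) (^-zeroˡ (suc N)) (^-monoˡ-≤ (suc N) 0<y))
exp-beats-linear (suc a) y c N a<y =
  2 * m , ≤-trans N≤m (m≤m+n m (m + 0)) ,
  <-≤-trans ([2mc+1]*a^2m<[1+a]^2m (suc a) c m (s≤s z≤n) (m≤n+m 1 (N + K)) K≤m) (^-monoˡ-≤ (2 * m) a<y)
  where
  K = suc a * suc a * (2 * c + 1)
  m = N + K + 1
  N≤m : N ≤ m
  N≤m = ≤-trans (m≤m+n N K) (m≤m+n (N + K) 1)
  K≤m : K ≤ m
  K≤m = ≤-trans (m≤n+m K N) (m≤m+n (N + K) 1)

∸-+-∸-+ : ∀ {i j c} → i ≤ c → j ≤ c → (c ∸ i) + (c ∸ j) + (i + j) ≡ c + c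
∸-+-∸-+ {i} {j} {c} i≤c j≤c =
  trans (interchange (c ∸ i) (c ∸ j) i j) (cong₂ _+_ (m∸n+n≡m i≤c) (m∸n+n≡m j≤c))
  where
  interchange : ∀ a b i j → a + b + (i + j) ≡ (a + i) + (b + j)
  interchange = solve-∀

∸-+-∸≡ : ∀ i j c → i + j ≡ c → (c ∸ i) + (c ∸ j) ≡ c
∸-+-∸≡ i j c i+j≡c = +-cancelʳ-≡ c _ c (begin
  (c ∸ i) + (c ∸ j) + c        ≡⟨ cong ((c ∸ i) + (c ∸ j) +_) i+j≡c ⟨
  (c ∸ i) + (c ∸ j) + (i + j)  ≡⟨ ∸-+-∸-+ (subst (i ≤_) i+j≡c (m≤m+n i j)) (subst (j ≤_) i+j≡c (m≤n+m j i)) ⟩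
  c + c                        ∎)
  where open ≡-Reasoning

∸-+-∸> : ∀ i j c → i + j < c → c < (c ∸ i) + (c ∸ j)
∸-+-∸> i j c i+j<c = +-cancelʳ-< (i + j) c _ (begin-strict
  c + (i + j)                  <⟨ +-monoʳ-< c i+j<c ⟩
  c + c                        ≡⟨ ∸-+-∸-+ (≤-trans (m≤m+n i j) (<⇒≤ i+j<c)) (≤-trans (m≤n+m j i) (<⇒≤ i+j<c)) ⟨
  (c ∸ i) + (c ∸ j) + (i + j)  ∎)
  where open ≤-Reasoning

<⇒≤∸1 : ∀ {m n} → m < n → m ≤ n ∸ 1
<⇒≤∸1 (s≤s m≤n) = m≤n

data All₃ {a p} {A : Set a} (P : A → A → A → Set p) :
    ∀ {n} → Vec A n × Vec A n × Vec A n → Set (a ⊔ p) where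
  []  : All₃ P ([] , [] , [])
  _∷_ : ∀ {n i j k} {xs ys zs : Vec A n} → P i j k → All₃ P (xs , ys , zs) → All₃ P (i ∷ xs , j ∷ ys , k ∷ zs)

All₃-map : ∀ {a p r} {A : Set a} {P : A → A → A → Set p} {R : A → A → A → Set r} →
  (∀ {i j k} → P i j k → R i j k) → ∀ {n} {t : Vec A n × Vec A n × Vec A n} → All₃ P t → All₃ R t
All₃-map f []       = []
All₃-map f (p ∷ ps) = f p ∷ All₃-map f ps

weight-^3-≥ : ∀ {q} (a b c : Fin q → ℕ) (D : ℕ) {n} {x y z : Vec (Fin q) n} →
  All₃ (λ i j k → D ^ 3 ≤ a i * b j * c k) (x , y , z) → (D ^ n) ^ 3 ≤ weight a x * weight b y * weight c z
weight-^3-≥ a b c D []       = ≤-refl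
weight-^3-≥ a b c D {suc n} {i ∷ x} {j ∷ y} {k ∷ z} (D³≤ ∷ D³≤s) = begin
  (D * D ^ n) ^ 3                                          ≡⟨ ^-distribʳ-* D (D ^ n) 3 ⟩
  D ^ 3 * (D ^ n) ^ 3                                      ≤⟨ *-mono-≤ D³≤ (weight-^3-≥ a b c D D³≤s) ⟩
  (a i * b j * c k) * (weight a x * weight b y * weight c z) ≡⟨ regroup (a i) (weight a x) (b j) (weight b y) (c k) (weight c z) ⟨
  (a i * weight a x) * (b j * weight b y) * (c k * weight c z) ∎
  where
  open ≤-Reasoning
  regroup : ∀ p P r R s S → (p * P) * (r * R) * (s * S) ≡ (p * r * s) * (P * R * S)
  regroup = solve-∀

module _ {f ℓ : Level} (F : Field f ℓ) where
  open Field F using (_≈_; 0#; 1#; 0≉1; inverse; setoid)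
    renaming (_*_ to _·_; refl to ≈-refl; sym to ≈-sym; trans to ≈-trans; *-cong to ·-cong; zeroˡ to ·-zeroˡ; zeroʳ to ·-zeroʳ;
              *-identityˡ to ·-identityˡ; *-comm to ·-comm; *-assoc to ·-assoc)
  import Relation.Binary.Reasoning.Setoid setoid as ≈-Reasoning

  ·≉0⇒ˡ≉0 : ∀ {x y} → ¬ (x · y) ≈ 0# → ¬ x ≈ 0#
  ·≉0⇒ˡ≉0 {x} {y} xy≉0 x≈0 = xy≉0 (begin
    x · y  ≈⟨ ·-cong x≈0 ≈-refl ⟩
    0# · y ≈⟨ ·-zeroˡ y ⟩
    0#     ∎)
    where open ≈-Reasoning

  ·≉0⇒ʳ≉0 : ∀ {x y} → ¬ (x · y) ≈ 0# → ¬ y ≈ 0#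
  ·≉0⇒ʳ≉0 {x} {y} xy≉0 y≈0 = xy≉0 (begin
    x · y  ≈⟨ ·-cong ≈-refl y≈0 ⟩
    x · 0# ≈⟨ ·-zeroʳ x ⟩
    0#     ∎)
    where open ≈-Reasoning

  ·-≉0 : ∀ {x y} → ¬ x ≈ 0# → ¬ y ≈ 0# → ¬ (x · y) ≈ 0#
  ·-≉0 {x} {y} x≉0 y≉0 xy≈0 with inverse x x≉0
  ... | x⁻¹ , xx⁻¹≈1 = y≉0 (begin
    y              ≈⟨ ·-identityˡ y ⟨
    1# · y         ≈⟨ ·-cong (≈-trans (≈-sym xx⁻¹≈1) (·-comm x x⁻¹)) ≈-refl ⟩
    (x⁻¹ · x) · y  ≈⟨ ·-assoc x⁻¹ x y ⟩
    x⁻¹ · (x · y)  ≈⟨ ·-cong ≈-refl xy≈0 ⟩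
    x⁻¹ · 0#       ≈⟨ ·-zeroʳ x⁻¹ ⟩
    0#             ∎)
    where open ≈-Reasoning

  module _ {q : ℕ} (T : Tensor F q) where

    power≉0⇒terms : ∀ {n} (x y z : Vec (Fin q) n) → ¬ power F T n x y z ≈ 0# → All₃ (IsTerm F T) (x , y , z)
    power≉0⇒terms []      []      []      _  = []
    power≉0⇒terms (i ∷ x) (j ∷ y) (k ∷ z) T≉0 = ·≉0⇒ˡ≉0 T≉0 ∷ power≉0⇒terms x y z (·≉0⇒ʳ≉0 T≉0)

    terms⇒power≉0 : ∀ {n} {x y z : Vec (Fin q) n} → All₃ (IsTerm F T) (x , y , z) → ¬ power F T n x y z ≈ 0#
    terms⇒power≉0 []       1≈0 = 0≉1 (≈-sym 1≈0)
    terms⇒power≉0 (t ∷ ts) = ·-≉0 t (terms⇒power≉0 ts)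

    support-terms : ∀ {n A B C} {L : List (Idx F q n)} → (∀ t → (t ∈ L) ⇔ InZeroedSupport F T n A B C t) →
      ∀ {t} → t ∈ L → All₃ (IsTerm F T) t
    support-terms L⇔support {x , y , z} t∈L = power≉0⇒terms x y z (proj₁ (Equivalence.to (L⇔support _) t∈L))

  LimsupAtLeast : ∀ {q} → Tensor F q → ℕ → Set _
  LimsupAtLeast T m = ∀ a b → a < m * suc b → ∀ N → ∃[ n ] (N ≤ n ×
    ∃[ s ] (HasIndependentZeroingOut F T n s × a ^ n < s * (suc b ^ n)))

  LimsupAtMost : ∀ {q} → Tensor F q → ℕ → Set _
  LimsupAtMost T m = ∀ a b → m * suc b < a → ∃[ N ] ∀ n → N ≤ n → ∀ s →
    HasIndependentZeroingOut F T n s → s * (suc b ^ n) < a ^ n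

  module Weighting {q : ℕ} (α β γ : Fin q → ℕ) (H : ℕ)
      (∑α<qH : ∑ q α < q * H) (∑β<qH : ∑ q β < q * H) (∑γ<qH : ∑ q γ < q * H) where

    Heavy : Fin q → Fin q → Fin q → Set
    Heavy i j k = 3 * H + 1 ≤ α i + β j + γ k

    D : ℕ
    D = margin H + H

    shift : (Fin q → ℕ) → Fin q → ℕ
    shift δ i = margin H + δ i

    ∑-shift-≤ : (δ : Fin q → ℕ) → ∑ q δ < q * H → ∑ q (shift δ) ≤ pred (q * D)
    ∑-shift-≤ δ ∑δ<qH = <⇒≤pred (begin-strict
      ∑ q (shift δ)                   ≡⟨ ∑-+ q (λ _ → margin H) δ ⟩
      ∑ q (λ _ → margin H) + ∑ q δ    ≡⟨ cong (_+ ∑ q δ) (∑-const q (margin H)) ⟩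
      q * margin H + ∑ q δ            <⟨ +-monoʳ-< (q * margin H) ∑δ<qH ⟩
      q * margin H + q * H            ≡⟨ *-distribˡ-+ q (margin H) H ⟨
      q * D                           ∎)
      where open ≤-Reasoning

    -- In a heavy term one of the three shifted weights reaches Dⁿ, and the independent terms have
    -- pairwise distinct x-, y- and z-parts, each of total shifted weight at most (q D - 1)ⁿ.
    heavy-independent-bound : ∀ {n} (L : List (Idx F q n)) → AllPairs (Disjoint F) L →
      (∀ {t} → t ∈ L → All₃ Heavy t) → length L * D ^ n ≤ 3 * pred (q * D) ^ n
    heavy-independent-bound {n} L independent heavy = begin
      length L * D ^ n                                  ≡⟨ sumBy-const (D ^ n) L ⟨
      sumBy (λ _ → D ^ n) L                             ≤⟨ sumBy-mono _ _ L (λ t∈L → one-coordinate-large _ (heavy t∈L)) ⟩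
      sumBy (λ t → Wx t + Wy t + Wz t) L                ≡⟨ sumBy-+ (λ t → Wx t + Wy t) Wz L ⟩
      sumBy (λ t → Wx t + Wy t) L + sumBy Wz L          ≡⟨ cong (_+ sumBy Wz L) (sumBy-+ Wx Wy L) ⟩
      sumBy Wx L + sumBy Wy L + sumBy Wz L              ≤⟨ +-mono-≤ (+-mono-≤ (bound α ∑α<qH proj₁ proj₁)
                                                                       (bound β ∑β<qH (proj₁ ∘ proj₂) (proj₁ ∘ proj₂)))
                                                             (bound γ ∑γ<qH (proj₂ ∘ proj₂) (proj₂ ∘ proj₂)) ⟩
      E ^ n + E ^ n + E ^ n                             ≡⟨ thrice (E ^ n) ⟩
      3 * E ^ n                                         ∎
      where
      open ≤-Reasoning
      E = pred (q * D)
      Wx Wy Wz : Idx F q n → ℕ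
      Wx (x , y , z) = weight (shift α) x
      Wy (x , y , z) = weight (shift β) y
      Wz (x , y , z) = weight (shift γ) z
      one-coordinate-large : (t : Idx F q n) → All₃ Heavy t → D ^ n ≤ Wx t + Wy t + Wz t
      one-coordinate-large t@(x , y , z) heavy-t = ^3≤*⇒≤+ (D ^ n) (Wx t) (Wy t) (Wz t)
        (weight-^3-≥ (shift α) (shift β) (shift γ) D
          (All₃-map (λ {i} {j} {k} → [K+c]^3≤[K+x][K+y][K+z] H (α i) (β j) (γ k)) heavy-t))
      bound : (δ : Fin q → ℕ) → ∑ q δ < q * H → (pr : Idx F q n → Vec (Fin q) n) →
        (∀ {s t} → Disjoint F s t → pr s ≢ pr t) → sumBy (weight (shift δ) ∘ pr) L ≤ E ^ n
      bound δ ∑δ<qH pr disjoint⇒≢ = ≤-trans (sumBy-weight-≤ (shift δ) pr (AllPairs.map disjoint⇒≢ independent))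
                                              (^-monoˡ-≤ n (∑-shift-≤ δ ∑δ<qH))
      thrice : ∀ x → x + x + x ≡ 3 * x
      thrice = solve-∀

    heavy-independent-bound-doubled : ∀ {n} E → q * D ≡ suc E → 1 ≤ E → 2 * (2 * E) ≤ n →
      (L : List (Idx F q n)) → AllPairs (Disjoint F) L → (∀ {t} → t ∈ L → All₃ Heavy t) →
      length L * (D + D) ^ n ≤ suc (2 * E) ^ n
    heavy-independent-bound-doubled {n} E qD≡1+E 1≤E 4E≤n L independent heavy = begin
      length L * (D + D) ^ n          ≡⟨ cong (λ d → length L * d ^ n) (cong (D +_) (sym (+-identityʳ D))) ⟩
      length L * (2 * D) ^ n          ≡⟨ cong (length L *_) (^-distribʳ-* 2 D n) ⟩
      length L * (2 ^ n * D ^ n)      ≡⟨ regroup (length L) (2 ^ n) (D ^ n) ⟩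
      length L * D ^ n * 2 ^ n        ≤⟨ *-monoˡ-≤ (2 ^ n) (heavy-independent-bound L independent heavy) ⟩
      3 * pred (q * D) ^ n * 2 ^ n    ≡⟨ cong (λ e → 3 * e ^ n * 2 ^ n) (cong pred qD≡1+E) ⟩
      3 * E ^ n * 2 ^ n               ≡⟨ regroup′ (E ^ n) (2 ^ n) ⟩
      3 * (2 ^ n * E ^ n)             ≡⟨ cong (3 *_) (^-distribʳ-* 2 E n) ⟨
      3 * (2 * E) ^ n                 ≤⟨ 3*x^n≤[1+x]^n (2 * E) n (≤-trans 1≤E (m≤m+n E (E + 0))) 4E≤n ⟩
      suc (2 * E) ^ n                 ∎
      where
      open ≤-Reasoning
      regroup : ∀ l t d → l * (t * d) ≡ l * d * t
      regroup = solve-∀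
      regroup′ : ∀ e t → 3 * e * t ≡ 3 * (t * e)
      regroup′ = solve-∀

    module _ (T : Tensor F q) where

      LightTerm : Set ℓ
      LightTerm = ∃[ i ] ∃[ j ] ∃[ k ] (IsTerm F T i j k × ¬ Heavy i j k)

      heavy-or-light : ∀ {n} {t : Idx F q n} → All₃ (IsTerm F T) t → All₃ Heavy t ⊎ LightTerm
      heavy-or-light []           = inj₁ []
      heavy-or-light {t = i ∷ _ , j ∷ _ , k ∷ _} (term ∷ terms) with 3 * H + 1 ≤? α i + β j + γ k
      ... | no  light = inj₂ (i , j , k , term , light)
      ... | yes heavy = Sum.map₁ (heavy ∷_) (heavy-or-light terms)

      all-heavy-or-light : ∀ {n} (L : List (Idx F q n)) → (∀ {t} → t ∈ L → All₃ (IsTerm F T) t) →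
        (∀ {t} → t ∈ L → All₃ Heavy t) ⊎ LightTerm
      all-heavy-or-light []      terms = inj₁ λ ()
      all-heavy-or-light (t ∷ L) terms with heavy-or-light (terms (here refl)) | all-heavy-or-light L (terms ∘ there)
      ... | inj₂ light | _          = inj₂ light
      ... | inj₁ _     | inj₂ light = inj₂ light
      ... | inj₁ h     | inj₁ hs    = inj₁ λ { (here refl) → h ; (there t∈L) → hs t∈L }

      -- With q D = E + 1, Ĩ(T) ≥ q yields independent sets of more than ((2E + 1) / 2D)ⁿ terms for large n.
      light-term : LimsupAtLeast T q → 1 ≤ q → 1 ≤ H → LightTerm
      light-term lower 1≤q 1≤H with m≤n⇒∃[o]m+o≡n (*-mono-≤ 1≤q (s≤s (≤-trans 1≤H (m≤n+m H (3 * H * H + H * H * H)))))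
      ... | o , 2+o≡qD = from-independent-set (lower (suc (2 * E)) b 2E+1<q[1+b] (2 * (2 * E)))
        where
        E b : ℕ
        E = suc o
        b = 3 * H * H + H * H * H + H + D
        2E+1<q[1+b] : suc (2 * E) < q * suc b
        2E+1<q[1+b] = ≤-reflexive (sym (begin
          q * (D + D)    ≡⟨ *-distribˡ-+ q D D ⟩
          q * D + q * D  ≡⟨ cong₂ _+_ (sym 2+o≡qD) (sym 2+o≡qD) ⟩
          suc E + suc E  ≡⟨ double-suc E ⟩
          suc (suc (2 * E)) ∎))
          where
          open ≡-Reasoning
          double-suc : ∀ E → suc E + suc E ≡ suc (suc (2 * E))
          double-suc = solve-∀
        from-independent-set : ∃[ n ] (2 * (2 * E) ≤ n ×
          ∃[ s ] (HasIndependentZeroingOut F T n s × suc (2 * E) ^ n < s * suc b ^ n)) → LightTerm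
        from-independent-set (n , 4E≤n , s , (_ , _ , _ , L , |L|≡s , independent , L⇔support) , many)
          with all-heavy-or-light L (support-terms T L⇔support)
        ... | inj₂ light = light
        ... | inj₁ heavy = ⊥-elim (<⇒≱ many (subst (λ s → s * (D + D) ^ n ≤ suc (2 * E) ^ n) |L|≡s
                (heavy-independent-bound-doubled E (sym 2+o≡qD) (s≤s z≤n) 4E≤n L independent heavy)))

module Triangular {f ℓ : Level} (F : Field f ℓ) {q : ℕ} (T : Tensor F q) (lowerTriangular : LowerTriangular F q T) where

  term-z-unique : ∀ {i j k k′} → IsTerm F T i j k → IsTerm F T i j k′ → k ≡ k′
  term-z-unique = proj₁ lowerTriangular _ _ _ _

  term⇒i+j<q : ∀ {i j k} → IsTerm F T i j k → toℕ i + toℕ j < q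
  term⇒i+j<q {i} {j} {k} term with q ≤? toℕ i + toℕ j
  ... | yes q≤i+j = ⊥-elim (proj₂ lowerTriangular i j k q≤i+j term)
  ... | no  q≰i+j = ≰⇒> q≰i+j

  diagonal-z-unique : ∀ {i j j′ k k′} → IsDiagonalTerm F q T (i , j , k) → IsDiagonalTerm F q T (i , j′ , k′) →
    j ≡ j′ × k ≡ k′
  diagonal-z-unique {i} {j} {j′} {k} {k′} (i+j≡ , term) (i+j′≡ , term′) =
    j≡j′ , term-z-unique term (subst (λ j → IsTerm F T i j k′) (sym j≡j′) term′)
    where
    j≡j′ : j ≡ j′
    j≡j′ = trans (i+j≡n∸1⇒j≡opposite[i] {i = i} i+j≡) (sym (i+j≡n∸1⇒j≡opposite[i] {i = i} i+j′≡))

  -- All terms off the position (i₀, j₀) of the diagonal are heavy, so a light term sits at (i₀, j₀).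
  module DiagonalPosition (i₀ j₀ : Fin q) (1+i₀+j₀≡q : suc (toℕ i₀ + toℕ j₀) ≡ q) where
    a b : ℕ
    a = toℕ i₀
    b = toℕ j₀

    H : ℕ
    H = 6 * suc (a + b)

    Xα Yα Xβ Yβ Zγ : ℕ
    Xα = 6 * a + 12 * b + 9
    Yα = 6 * b + 5
    Xβ = 12 * a + 6 * b + 9
    Yβ = 6 * a + 5
    Zγ = 6 * a + 6 * b + 5

    α β γ : Fin q → ℕ
    α i = below a Xα Yα (toℕ i)
    β j = below b Xβ Yβ (toℕ j)
    γ k = Zγ

    slack : ∀ {x y} d → suc x + d ≡ y → x < y
    slack {x} d x+d≡y = subst (suc x ≤_) x+d≡y (m≤m+n (suc x) d)

    under-qH : ∀ {x} d → suc x + d ≡ suc (a + b) * H → x < q * H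
    under-qH d x+d≡ = subst (λ n → _ < n * H) 1+i₀+j₀≡q (slack d x+d≡)

    q∸a≡1+b : q ∸ a ≡ suc b
    q∸a≡1+b = trans (cong (_∸ a) (trans (sym 1+i₀+j₀≡q) (sym (+-suc a b)))) (m+n∸m≡n a (suc b))

    q∸b≡1+a : q ∸ b ≡ suc a
    q∸b≡1+a = trans (cong (_∸ b) (trans (sym 1+i₀+j₀≡q) (trans (cong suc (+-comm a b)) (sym (+-suc b a)))))
                (m+n∸m≡n b (suc a))

    ∑α<qH : ∑ q α < q * H
    ∑α<qH = subst (_< q * H) (sym ∑α≡) (under-qH (3 * a + b) (identity a b))
      where
      ∑α≡ : ∑ q α ≡ a * Xα + suc b * Yα
      ∑α≡ = trans (∑-below a q Xα Yα (subst (a ≤_) 1+i₀+j₀≡q (≤-trans (m≤m+n a b) (n≤1+n _))))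
                  (cong (λ w → a * Xα + w * Yα) q∸a≡1+b)
      identity : ∀ a b → suc (a * (6 * a + 12 * b + 9) + suc b * (6 * b + 5)) + (3 * a + b)
                         ≡ suc (a + b) * (6 * suc (a + b))
      identity = solve-∀

    ∑β<qH : ∑ q β < q * H
    ∑β<qH = subst (_< q * H) (sym ∑β≡) (under-qH (3 * b + a) (identity a b))
      where
      ∑β≡ : ∑ q β ≡ b * Xβ + suc a * Yβ
      ∑β≡ = trans (∑-below b q Xβ Yβ (subst (b ≤_) 1+i₀+j₀≡q (≤-trans (m≤n+m b a) (n≤1+n _))))
                  (cong (λ w → b * Xβ + w * Yβ) q∸b≡1+a)
      identity : ∀ a b → suc (b * (12 * a + 6 * b + 9) + suc a * (6 * a + 5)) + (3 * b + a)
                         ≡ suc (a + b) * (6 * suc (a + b))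
      identity = solve-∀

    ∑γ<qH : ∑ q γ < q * H
    ∑γ<qH = subst (_< q * H) (sym (∑-const q Zγ))
              (subst (λ n → n * Zγ < n * H) 1+i₀+j₀≡q (slack (a + b) (identity a b)))
      where
      identity : ∀ a b → suc (suc (a + b) * (6 * a + 6 * b + 5)) + (a + b) ≡ suc (a + b) * (6 * suc (a + b))
      identity = solve-∀

    open Weighting F α β γ H ∑α<qH ∑β<qH ∑γ<qH using (Heavy; LightTerm; light-term)

    heavy-or-at-position : ∀ {i j k} → IsTerm F T i j k → Heavy i j k ⊎ (i ≡ i₀ × j ≡ j₀)
    heavy-or-at-position {i} {j} term with toℕ i <? a | toℕ j <? b
    ... | yes i<a | yes j<b rewrite below-< {X = Xα} {Yα} i<a
                                  | below-< {X = Xβ} {Yβ} j<b =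
      inj₁ (subst (3 * H + 1 ≤_) (identity a b) (m≤m+n (3 * H + 1) (6 * a + 6 * b + 4)))
      where
      identity : ∀ a b → 3 * (6 * suc (a + b)) + 1 + (6 * a + 6 * b + 4)
                         ≡ (6 * a + 12 * b + 9) + (12 * a + 6 * b + 9) + (6 * a + 6 * b + 5)
      identity = solve-∀
    ... | yes i<a | no j≮b rewrite below-< {X = Xα} {Yα} i<a
                                 | below-≥ {X = Xβ} {Yβ} (≮⇒≥ j≮b) =
      inj₁ (≤-reflexive (identity a b))
      where
      identity : ∀ a b → 3 * (6 * suc (a + b)) + 1 ≡ (6 * a + 12 * b + 9) + (6 * a + 5) + (6 * a + 6 * b + 5)
      identity = solve-∀
    ... | no i≮a | yes j<b rewrite below-≥ {X = Xα} {Yα} (≮⇒≥ i≮a)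
                                 | below-< {X = Xβ} {Yβ} j<b =
      inj₁ (≤-reflexive (identity a b))
      where
      identity : ∀ a b → 3 * (6 * suc (a + b)) + 1 ≡ (6 * b + 5) + (12 * a + 6 * b + 9) + (6 * a + 6 * b + 5)
      identity = solve-∀
    ... | no i≮a | no j≮b
      with +-squeeze (≮⇒≥ i≮a) (≮⇒≥ j≮b) (≤-antisym (+-mono-≤ (≮⇒≥ i≮a) (≮⇒≥ j≮b)) i+j≤a+b)
      where
      i+j≤a+b : toℕ i + toℕ j ≤ a + b
      i+j≤a+b = ≤-pred (subst (toℕ i + toℕ j <_) (sym 1+i₀+j₀≡q) (term⇒i+j<q term))
    ...   | a≡i , b≡j = inj₂ (toℕ-injective (sym a≡i) , toℕ-injective (sym b≡j))

    term-at-position : LimsupAtLeast F T q → ∃[ k ] IsTerm F T i₀ j₀ k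
    term-at-position lower = at-position (light-term T lower (subst (1 ≤_) 1+i₀+j₀≡q (s≤s z≤n)) (s≤s z≤n))
      where
      at-position : LightTerm T → ∃[ k ] IsTerm F T i₀ j₀ k
      at-position (i , j , k , term , light) =
        [ (λ heavy → ⊥-elim (light heavy)) , (λ { (refl , refl) → k , term }) ]′ (heavy-or-at-position term)

  diagonal-term : LimsupAtLeast F T q → ∀ i → ∃[ k ] IsTerm F T i (opposite i) k
  diagonal-term lower i = DiagonalPosition.term-at-position i (opposite i) (suc[i+opposite[i]]≡n i) lower

  diagonal-i-unique : ∀ {i i′ j : Fin q} → toℕ i + toℕ j ≡ q ∸ 1 → toℕ i′ + toℕ j ≡ q ∸ 1 → i ≡ i′
  diagonal-i-unique {i} {i′} {j} i+j≡ i′+j≡ =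
    toℕ-injective (+-cancelʳ-≡ (toℕ j) (toℕ i) (toℕ i′) (trans i+j≡ (sym i′+j≡)))

  diagonal-triple : (Fin q → Fin q) → Fin q → Fin q × Fin q × Fin q
  diagonal-triple z i = i , opposite i , z i

  QDiagonalDistinctZ-intro : (z : Fin q → Fin q) → (∀ i → IsTerm F T i (opposite i) (z i)) →
    (∀ {i j i′ j′ k} → toℕ i < toℕ i′ → IsDiagonalTerm F q T (i , j , k) → IsDiagonalTerm F q T (i′ , j′ , k) → ⊥) →
    QDiagonalDistinctZ F q T
  QDiagonalDistinctZ-intro z zT no-collision = (L , |L|≡q , L-unique , L⇔diagonal) , distinct-z
    where
    L = map (diagonal-triple z) (allFin q)
    |L|≡q : length L ≡ q
    |L|≡q = trans (length-map _ (allFin q)) (length-tabulate _)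
    L-unique : AllPairs _≢_ L
    L-unique = AllPairs.map⁺ (AllPairs.tabulate⁺ (λ i≢j → i≢j ∘ cong proj₁))
    L⇔diagonal : ∀ t → (t ∈ L) ⇔ IsDiagonalTerm F q T t
    L⇔diagonal (i , j , k) = mk⇔ to from
      where
      to : (i , j , k) ∈ L → IsDiagonalTerm F q T (i , j , k)
      to t∈L with i′ , _ , refl ← ∈-map⁻ (diagonal-triple z) t∈L = i+opposite[i]≡n∸1 i′ , zT i′
      from : IsDiagonalTerm F q T (i , j , k) → (i , j , k) ∈ L
      from diag with diagonal-z-unique diag (i+opposite[i]≡n∸1 i , zT i)
      ... | refl , refl = ∈-map⁺ (diagonal-triple z) (∈-allFin i)
    distinct-z : ∀ i j k i′ j′ k′ → IsDiagonalTerm F q T (i , j , k) → IsDiagonalTerm F q T (i′ , j′ , k′) →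
      ¬ ((i , j , k) ≡ (i′ , j′ , k′)) → k ≢ k′
    distinct-z i j k i′ j′ k′ diag diag′ t≢t′ refl with <-cmp (toℕ i) (toℕ i′)
    ... | tri< i<i′ _ _ = no-collision i<i′ diag diag′
    ... | tri> _ _ i′<i = no-collision i′<i diag′ diag
    ... | tri≈ _ i≡i′ _ with refl ← toℕ-injective i≡i′ with refl , _ ← diagonal-z-unique diag diag′ =
      t≢t′ refl

-- Weights under which every term is heavy, given two diagonal terms sharing the variable z_k₀.
module CollidingDiagonal {f ℓ : Level} (F : Field f ℓ) {p : ℕ} (T : Tensor F (suc (suc p)))
    (lowerTriangular : LowerTriangular F (suc (suc p)) T) {i₁ j₁ i₂ j₂ k₀ : Fin (suc (suc p))}
    (i₁<i₂ : toℕ i₁ < toℕ i₂)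
    (diag₁ : IsDiagonalTerm F (suc (suc p)) T (i₁ , j₁ , k₀)) (diag₂ : IsDiagonalTerm F (suc (suc p)) T (i₂ , j₂ , k₀)) where

  open Triangular F T lowerTriangular

  Q c W Z X Y H : ℕ
  Q = suc (suc p)
  c = suc p
  W = 4 * Q + 2
  Z = 2 * Q + 3
  X = 2 * p * p + 12 * p + 12
  Y = 2 * p * p + 9 * p + 7
  H = (2 * Q + 1) * Q

  α β γ : Fin Q → ℕ
  α i = (c ∸ toℕ i) * W + onlyAt i₁ 2 Z i
  β j = (c ∸ toℕ j) * W + onlyAt j₂ 2 Z j
  γ k = onlyAt k₀ X Y k

  ∑-ramp-onlyAt : (i₀ : Fin Q) → suc (∑ Q (λ i → (c ∸ toℕ i) * W + onlyAt i₀ 2 Z i)) ≡ Q * H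
  ∑-ramp-onlyAt i₀ = begin
    suc (∑ Q (λ i → (c ∸ toℕ i) * W + onlyAt i₀ 2 Z i))
      ≡⟨ cong suc (∑-+ Q (λ i → (c ∸ toℕ i) * W) (onlyAt i₀ 2 Z)) ⟩
    suc (∑ Q (λ i → (c ∸ toℕ i) * W) + ∑ Q (onlyAt i₀ 2 Z))
      ≡⟨ cong₂ (λ s t → suc (s + t)) (∑-*ʳ Q (λ i → c ∸ toℕ i) W) (∑-onlyAt c i₀ 2 Z) ⟩
    suc (∑ Q (λ i → c ∸ toℕ i) * W + (2 + c * Z))                 ≡⟨ exact (∑ Q (λ i → c ∸ toℕ i)) (∑-countdown c) ⟩
    Q * H                                                        ∎
    where
    open ≡-Reasoning
    exact : ∀ s → 2 * s ≡ c * Q → suc (s * W + (2 + c * Z)) ≡ Q * H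
    exact s 2s≡cQ = trans (cong (λ w → suc (w + (2 + c * Z))) (double s p))
                      (trans (cong (λ w → suc (w * (2 * Q + 1) + (2 + c * Z))) 2s≡cQ) (identity p))
      where
      double : ∀ s p → s * (4 * suc (suc p) + 2) ≡ 2 * s * (2 * suc (suc p) + 1)
      double = solve-∀
      identity : ∀ p → suc (suc p * suc (suc p) * (2 * suc (suc p) + 1) + (2 + suc p * (2 * suc (suc p) + 3)))
                       ≡ suc (suc p) * ((2 * suc (suc p) + 1) * suc (suc p))
      identity = solve-∀

  ∑γ≡ : suc (∑ Q γ) ≡ Q * H
  ∑γ≡ = trans (cong suc (∑-onlyAt c k₀ X Y)) (identity p)
    where
    identity : ∀ p → suc ((2 * p * p + 12 * p + 12) + suc p * (2 * p * p + 9 * p + 7))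
                     ≡ suc (suc p) * ((2 * suc (suc p) + 1) * suc (suc p))
    identity = solve-∀

  open Weighting F α β γ H (≤-reflexive (∑-ramp-onlyAt i₁)) (≤-reflexive (∑-ramp-onlyAt j₂)) (≤-reflexive ∑γ≡)
    using (Heavy; LightTerm; light-term)

  regroup : ∀ u v a b g → (u * W + a) + (v * W + b) + g ≡ (u + v) * W + (a + b + g)
  regroup u v a b g = identity u v a b g W
    where
    identity : ∀ u v a b g w → (u * w + a) + (v * w + b) + g ≡ (u + v) * w + (a + b + g)
    identity = solve-∀

  heavy-below-diagonal : ∀ u v a b g → Q ≤ u + v → 2 ≤ a → 2 ≤ b → Y ≤ g →
    3 * H + 1 ≤ (u * W + a) + (v * W + b) + g
  heavy-below-diagonal u v a b g Q≤u+v 2≤a 2≤b Y≤g = begin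
    3 * H + 1                           ≡⟨ identity p ⟩
    Q * W + (2 + 2 + Y)                 ≤⟨ +-mono-≤ (*-monoˡ-≤ W Q≤u+v) (+-mono-≤ (+-mono-≤ 2≤a 2≤b) Y≤g) ⟩
    (u + v) * W + (a + b + g)           ≡⟨ regroup u v a b g ⟨
    (u * W + a) + (v * W + b) + g       ∎
    where
    open ≤-Reasoning
    identity : ∀ p → 3 * ((2 * suc (suc p) + 1) * suc (suc p)) + 1
                     ≡ suc (suc p) * (4 * suc (suc p) + 2) + (2 + 2 + (2 * p * p + 9 * p + 7))
    identity = solve-∀

  heavy-on-diagonal : ∀ u v g → u + v ≡ c → Y ≤ g → 3 * H + 1 ≤ (u * W + Z) + (v * W + Z) + g
  heavy-on-diagonal u v g u+v≡c Y≤g = begin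
    3 * H + 1                           ≡⟨ identity p ⟩
    c * W + (Z + Z + Y)                 ≤⟨ +-mono-≤ (≤-reflexive (cong (_* W) (sym u+v≡c))) (+-monoʳ-≤ (Z + Z) Y≤g) ⟩
    (u + v) * W + (Z + Z + g)           ≡⟨ regroup u v Z Z g ⟨
    (u * W + Z) + (v * W + Z) + g       ∎
    where
    open ≤-Reasoning
    identity : ∀ p → 3 * ((2 * suc (suc p) + 1) * suc (suc p)) + 1
                     ≡ suc p * (4 * suc (suc p) + 2) + ((2 * suc (suc p) + 3) + (2 * suc (suc p) + 3) + (2 * p * p + 9 * p + 7))
    identity = solve-∀

  heavy-at-collision : ∀ u v a b → u + v ≡ c → a + b ≡ 2 + Z → 3 * H + 1 ≤ (u * W + a) + (v * W + b) + X
  heavy-at-collision u v a b u+v≡c a+b≡2+Z = begin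
    3 * H + 1                           ≤⟨ m≤m+n (3 * H + 1) p ⟩
    3 * H + 1 + p                       ≡⟨ identity p ⟨
    c * W + ((2 + Z) + X)               ≡⟨ cong₂ (λ s t → s * W + (t + X)) (sym u+v≡c) (sym a+b≡2+Z) ⟩
    (u + v) * W + (a + b + X)           ≡⟨ regroup u v a b X ⟨
    (u * W + a) + (v * W + b) + X       ∎
    where
    open ≤-Reasoning
    identity : ∀ p → suc p * (4 * suc (suc p) + 2) + ((2 + (2 * suc (suc p) + 3)) + (2 * p * p + 12 * p + 12))
                     ≡ 3 * ((2 * suc (suc p) + 1) * suc (suc p)) + 1 + p
    identity = solve-∀

  Y≤γ : ∀ k → Y ≤ γ k
  Y≤γ k = onlyAt-≥ k₀ k (≤-trans (m≤m+n Y (3 * p + 5)) (≤-reflexive (identity p))) ≤-refl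
    where
    identity : ∀ p → (2 * p * p + 9 * p + 7) + (3 * p + 5) ≡ 2 * p * p + 12 * p + 12
    identity = solve-∀

  i₁≢i₂ : i₁ ≢ i₂
  i₁≢i₂ i₁≡i₂ = <-irrefl (cong toℕ i₁≡i₂) i₁<i₂

  j₂≡j⇒i≡i₂ : ∀ {i j : Fin Q} → toℕ i + toℕ j ≡ c → j₂ ≡ j → i ≡ i₂
  j₂≡j⇒i≡i₂ {i} i+j≡c refl = diagonal-i-unique {i} {i₂} i+j≡c (proj₁ diag₂)

  heavy-at-i₁ : ∀ {j k} → IsDiagonalTerm F Q T (i₁ , j , k) → Heavy i₁ j k
  heavy-at-i₁ diag with diagonal-z-unique diag diag₁
  ... | refl , refl = subst (λ g → 3 * H + 1 ≤ α i₁ + β j₁ + g) (sym (onlyAt-≡ k₀ X Y))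
    (heavy-at-collision (c ∸ toℕ i₁) (c ∸ toℕ j₁) (onlyAt i₁ 2 Z i₁) (onlyAt j₂ 2 Z j₁)
      (∸-+-∸≡ (toℕ i₁) (toℕ j₁) c (proj₁ diag₁))
      (cong₂ _+_ (onlyAt-≡ i₁ 2 Z) (onlyAt-≢ 2 Z (i₁≢i₂ ∘ j₂≡j⇒i≡i₂ (proj₁ diag₁)))))

  heavy-at-i₂ : ∀ {j k} → IsDiagonalTerm F Q T (i₂ , j , k) → Heavy i₂ j k
  heavy-at-i₂ diag with diagonal-z-unique diag diag₂
  ... | refl , refl = subst (λ g → 3 * H + 1 ≤ α i₂ + β j₂ + g) (sym (onlyAt-≡ k₀ X Y))
    (heavy-at-collision (c ∸ toℕ i₂) (c ∸ toℕ j₂) (onlyAt i₁ 2 Z i₂) (onlyAt j₂ 2 Z j₂)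
      (∸-+-∸≡ (toℕ i₂) (toℕ j₂) c (proj₁ diag₂))
      (trans (cong₂ _+_ (onlyAt-≢ 2 Z (i₁≢i₂)) (onlyAt-≡ j₂ 2 Z)) (+-comm Z 2)))

  heavy-elsewhere-on-diagonal : ∀ {i j k} → i ≢ i₁ → i ≢ i₂ → toℕ i + toℕ j ≡ c → Heavy i j k
  heavy-elsewhere-on-diagonal {i} {j} {k} i≢i₁ i≢i₂ i+j≡c =
    subst₂ (λ a b → 3 * H + 1 ≤ ((c ∸ toℕ i) * W + a) + ((c ∸ toℕ j) * W + b) + γ k)
      (sym (onlyAt-≢ 2 Z (i≢i₁ ∘ sym))) (sym (onlyAt-≢ 2 Z (i≢i₂ ∘ j₂≡j⇒i≡i₂ i+j≡c)))
      (heavy-on-diagonal (c ∸ toℕ i) (c ∸ toℕ j) (γ k) (∸-+-∸≡ (toℕ i) (toℕ j) c i+j≡c) (Y≤γ k))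

  heavy-diagonal : ∀ {i j k} → IsDiagonalTerm F Q T (i , j , k) → Heavy i j k
  heavy-diagonal {i} diag with i Fin.≟ i₁ | i Fin.≟ i₂
  ... | yes refl | _        = heavy-at-i₁ diag
  ... | no  _    | yes refl = heavy-at-i₂ diag
  ... | no i≢i₁  | no i≢i₂  = heavy-elsewhere-on-diagonal i≢i₁ i≢i₂ (proj₁ diag)

  heavy : ∀ {i j k} → IsTerm F T i j k → Heavy i j k
  heavy {i} {j} {k} term with suc (toℕ i + toℕ j) ≤? c
  ... | yes i+j<c = heavy-below-diagonal (c ∸ toℕ i) (c ∸ toℕ j) (onlyAt i₁ 2 Z i) (onlyAt j₂ 2 Z j) (γ k)
                      (∸-+-∸> (toℕ i) (toℕ j) c i+j<c)
                      (onlyAt-≥ i₁ i ≤-refl (s≤s (s≤s z≤n))) (onlyAt-≥ j₂ j ≤-refl (s≤s (s≤s z≤n))) (Y≤γ k)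
  ... | no  i+j≮c = heavy-diagonal (≤-antisym (≤-pred (term⇒i+j<q term)) (≮⇒≥ i+j≮c) , term)

  impossible : LimsupAtLeast F T Q → ⊥
  impossible lower = all-heavy (light-term T lower (s≤s z≤n) (s≤s z≤n))
    where
    all-heavy : LightTerm T → ⊥
    all-heavy (_ , _ , _ , term , light) = light (heavy term)

diagonal-z-distinct : ∀ {f ℓ} (F : Field f ℓ) {q} (T : Tensor F q) → LowerTriangular F q T → LimsupAtLeast F T q →
  ∀ {i j i′ j′ k} → toℕ i < toℕ i′ → IsDiagonalTerm F q T (i , j , k) → IsDiagonalTerm F q T (i′ , j′ , k) → ⊥
diagonal-z-distinct F {suc zero}    T _               _     {zero} {i′ = zero} ()
diagonal-z-distinct F {suc (suc p)} T lowerTriangular lower i<i′ diag diag′ =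
  CollidingDiagonal.impossible F T lowerTriangular i<i′ diag diag′ lower

module _ {f ℓ : Level} (F : Field f ℓ) {q : ℕ} (T : Tensor F q) (lowerTriangular : LowerTriangular F q T) where

  open Triangular F T lowerTriangular

  diagonal-term-or-absent : (i : Fin q) (L : List (Fin q × Fin q × Fin q)) → All (IsDiagonalTerm F q T) L →
    (∃[ k ] IsTerm F T i (opposite i) k) ⊎ All (λ t → proj₁ t ≢ i) L
  diagonal-term-or-absent i []                []              = inj₂ []
  diagonal-term-or-absent i ((i′ , j , k) ∷ L) ((i′+j≡ , term) ∷ diags) with i′ Fin.≟ i
  ... | yes refl = inj₁ (k , subst (λ j → IsTerm F T i′ j k) (i+j≡n∸1⇒j≡opposite[i] i′+j≡) term)
  ... | no  i′≢i = Sum.map₂ (i′≢i ∷_) (diagonal-term-or-absent i L diags)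

  diagonal-choice : QDiagonalDistinctZ F q T →
    Σ (Fin q → Fin q) λ z → (∀ i → IsTerm F T i (opposite i) (z i)) × (∀ {i i′} → z i ≡ z i′ → i ≡ i′)
  diagonal-choice ((L , |L|≡q , L-unique , L⇔diagonal) , distinct-z) = z , zT , z-injective
    where
    diags : All (IsDiagonalTerm F q T) L
    diags = All.tabulate (λ {t} t∈L → Equivalence.to (L⇔diagonal t) t∈L)
    rows-unique : Unique (map proj₁ L)
    rows-unique = AllPairs.map⁺ (AllPairs-mapWithAll same-row⇒same-triple diags L-unique)
      where
      same-row⇒same-triple : ∀ {t t′} → IsDiagonalTerm F q T t → IsDiagonalTerm F q T t′ → t ≢ t′ → proj₁ t ≢ proj₁ t′
      same-row⇒same-triple diag diag′ t≢t′ refl with refl , refl ← diagonal-z-unique diag diag′ = t≢t′ refl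
    found : ∀ i → ∃[ k ] IsTerm F T i (opposite i) k
    found i with diagonal-term-or-absent i L diags
    ... | inj₁ term   = term
    ... | inj₂ absent = ⊥-elim (<-irrefl refl (begin-strict
      q                                 ≡⟨ trans (sym |L|≡q) (sym (length-map proj₁ L)) ⟩
      length (map proj₁ L)              ≤⟨ length-mono-⊆ rows-unique rows⊆ ⟩
      length (allFin q ─ ∈-allFin i)    <⟨ ≤-reflexive (trans (length-─ (∈-allFin i)) (length-tabulate _)) ⟩
      q                                 ∎))
      where
      open ≤-Reasoning
      rows⊆ : map proj₁ L ⊆ allFin q ─ ∈-allFin i
      rows⊆ x∈rows with t , t∈L , refl ← ∈-map⁻ proj₁ x∈rows = ∈-─ (∈-allFin i) (∈-allFin _) (All.lookup absent t∈L)
    z : Fin q → Fin q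
    z = proj₁ ∘ found
    zT : ∀ i → IsTerm F T i (opposite i) (z i)
    zT = proj₂ ∘ found
    z-injective : ∀ {i i′} → z i ≡ z i′ → i ≡ i′
    z-injective {i} {i′} zi≡zi′ with i Fin.≟ i′
    ... | yes i≡i′ = i≡i′
    ... | no  i≢i′ = ⊥-elim (distinct-z i (opposite i) (z i) i′ (opposite i′) (z i′)
                       (i+opposite[i]≡n∸1 i , zT i) (i+opposite[i]≡n∸1 i′ , zT i′) (i≢i′ ∘ cong proj₁) zi≡zi′)

  module _ (z : Fin q → Fin q) (zT : ∀ i → IsTerm F T i (opposite i) (z i))
           (z-injective : ∀ {i i′} → z i ≡ z i′ → i ≡ i′) where

    diagonal-vector : ∀ {n} → Vec (Fin q) n → Idx F q n
    diagonal-vector v = v , Vec.map opposite v , Vec.map z v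

    diagonal-vector-terms : ∀ {n} (v : Vec (Fin q) n) → All₃ (IsTerm F T) (diagonal-vector v)
    diagonal-vector-terms []      = []
    diagonal-vector-terms (i ∷ v) = zT i ∷ diagonal-vector-terms v

    terms⇒digit-sum-≤ : ∀ {n} {x y w : Vec (Fin q) n} → All₃ (IsTerm F T) (x , y , w) →
      digit-sum x + digit-sum y ≤ n * (q ∸ 1)
    terms⇒digit-sum-≤ []                                  = z≤n
    terms⇒digit-sum-≤ {suc n} {i ∷ x} {j ∷ y} (term ∷ terms) =
      subst (_≤ (q ∸ 1) + n * (q ∸ 1)) (+-interchange (toℕ i) (toℕ j) (digit-sum x) (digit-sum y))
        (+-mono-≤ (<⇒≤∸1 (term⇒i+j<q term)) (terms⇒digit-sum-≤ terms))

    top-level-term : ∀ {n} {x y w : Vec (Fin q) n} → All₃ (IsTerm F T) (x , y , w) →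
      digit-sum x + digit-sum y ≡ n * (q ∸ 1) → (x , y , w) ≡ diagonal-vector x
    top-level-term []                                            _   = refl
    top-level-term {x = i ∷ x} {j ∷ y} {k ∷ w} (term ∷ terms) top
      with i+j≡ , rest≡ ← +-squeeze (<⇒≤∸1 (term⇒i+j<q term)) (terms⇒digit-sum-≤ terms)
                            (trans (+-interchange (toℕ i) (toℕ j) (digit-sum x) (digit-sum y)) top)
      with refl ← i+j≡n∸1⇒j≡opposite[i] {i = i} {j} i+j≡
      with refl ← top-level-term terms rest≡
      with refl ← term-z-unique term (zT i) = refl

    level : ∀ {n} → Vec (Fin q) n → Fin (suc (n * (q ∸ 1)))
    level v = fromℕ< (s≤s (digit-sum-≤ v))

    -- By  top-level-term  only products of diagonal terms survive; they are pairwise disjoint since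
    -- opposite and z are injective.
    level-zeroing-out : ∀ n (c : Fin (suc (n * (q ∸ 1)))) →
      HasIndependentZeroingOut F T n (length (filter (inClass? (level {n}) c) (vecs q n)))
    level-zeroing-out n c = InLevel , Complementary , (λ _ → ⊤) , map diagonal-vector level-c ,
      length-map diagonal-vector level-c , independent , L⇔support
      where
      level-c = filter (inClass? (level {n}) c) (vecs q n)
      InLevel Complementary : Vec (Fin q) n → Set
      InLevel x       = level x ≡ c
      Complementary y = digit-sum y + toℕ c ≡ n * (q ∸ 1)
      digit-sum≡c : ∀ {x} → InLevel x → digit-sum x ≡ toℕ c
      digit-sum≡c refl = sym (toℕ-fromℕ< _)
      independent : AllPairs.AllPairs (Disjoint F) (map diagonal-vector level-c)
      independent = AllPairs.map⁺ (AllPairs.map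
                      (λ v≢w → v≢w , v≢w ∘ map-injective opposite-injective , v≢w ∘ map-injective z-injective)
                      (Unique.filter⁺ (inClass? (level {n}) c) (vecs-unique q n)))
      L⇔support : ∀ t → (t ∈ map diagonal-vector level-c) ⇔ InZeroedSupport F T n InLevel Complementary (λ _ → ⊤) t
      L⇔support (x , y , w) = mk⇔ to from
        where
        to : (x , y , w) ∈ map diagonal-vector level-c → InZeroedSupport F T n InLevel Complementary (λ _ → ⊤) (x , y , w)
        to t∈L with v , v∈level-c , refl ← ∈-map⁻ diagonal-vector t∈L
               with _ , level-v≡c ← ∈-filter⁻ (inClass? (level {n}) c) {xs = vecs q n} v∈level-c =
          terms⇒power≉0 F T (diagonal-vector-terms v) , level-v≡c ,
          trans (cong (digit-sum (Vec.map opposite v) +_) (sym (digit-sum≡c {v} level-v≡c)))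
                (trans (+-comm (digit-sum (Vec.map opposite v)) (digit-sum v)) (digit-sum-opposite v)) ,
          tt
        from : InZeroedSupport F T n InLevel Complementary (λ _ → ⊤) (x , y , w) → (x , y , w) ∈ map diagonal-vector level-c
        from (T≉0 , in-level , complementary , _)
          with refl ← top-level-term (power≉0⇒terms F T x y w T≉0)
                        (trans (cong (_+ digit-sum y) (digit-sum≡c {x} in-level)) (trans (+-comm (toℕ c) (digit-sum y)) complementary)) =
          ∈-map⁺ diagonal-vector (∈-filter⁺ (inClass? (level {n}) c) (∈-vecs x) in-level)

    -- Among the n (q - 1) + 1 levels one holds at least qⁿ / (n (q - 1) + 1) vectors, and the
    -- linear loss is negligible against the exponential gain.
    limsup≥q : LimsupAtLeast F T q
    limsup≥q a b a<q[1+b] N = choose-n (exp-beats-linear a (q * suc b) (q ∸ 1) N a<q[1+b])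
      where
      choose-n : ∃[ n ] (N ≤ n × (n * (q ∸ 1) + 1) * a ^ n < (q * suc b) ^ n) →
        ∃[ n ] (N ≤ n × ∃[ s ] (HasIndependentZeroingOut F T n s × a ^ n < s * (suc b ^ n)))
      choose-n (n , N≤n , small) = n , N≤n , s , level-zeroing-out n c , *-cancelˡ-< (suc M) _ _ (begin-strict
        suc M * a ^ n                          ≡⟨ cong (_* a ^ n) (+-comm 1 M) ⟩
        (M + 1) * a ^ n                        <⟨ small ⟩
        (q * suc b) ^ n                        ≡⟨ ^-distribʳ-* q (suc b) n ⟩
        q ^ n * suc b ^ n
          ≡⟨ cong (_* suc b ^ n) (trans (sym (length-vecs q n)) (sym (∑-length-filter level (vecs q n)))) ⟩
        ∑ (suc M) (λ c → length (filter (inClass? (level {n}) c) (vecs q n))) * suc b ^ n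
                                               ≤⟨ *-monoˡ-≤ (suc b ^ n) largest-level ⟩
        suc M * s * suc b ^ n                  ≡⟨ *-assoc (suc M) s (suc b ^ n) ⟩
        suc M * (s * suc b ^ n)                ∎)
        where
        open ≤-Reasoning
        M = n * (q ∸ 1)
        c = proj₁ (pigeonhole M (λ c → length (filter (inClass? (level {n}) c) (vecs q n))))
        s = length (filter (inClass? (level {n}) c) (vecs q n))
        largest-level = proj₂ (pigeonhole M (λ c → length (filter (inClass? (level {n}) c) (vecs q n))))

module _ {f ℓ : Level} (F : Field f ℓ) where

  limsup≤q : ∀ {q} (T : Tensor F q) → LimsupAtMost F T q
  limsup≤q {q} T a b q[1+b]<a = 1 , bounded
    where
    open ≤-Reasoning
    s≤qⁿ : ∀ {n s} (L : List (Idx F q n)) → length L ≡ s → AllPairs.AllPairs (Disjoint F) L → s ≤ q ^ n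
    s≤qⁿ {n} L |L|≡s independent = begin
      _                       ≡⟨ trans (sym |L|≡s) (sym (length-map proj₁ L)) ⟩
      length (map proj₁ L)    ≤⟨ length-mono-⊆ (AllPairs.map⁺ (AllPairs.map proj₁ independent)) (λ _ → ∈-vecs _) ⟩
      length (vecs q n)       ≡⟨ length-vecs q n ⟩
      q ^ n                   ∎
    bounded : ∀ n → 1 ≤ n → ∀ s → HasIndependentZeroingOut F T n s → s * suc b ^ n < a ^ n
    bounded (suc n) _ s (_ , _ , _ , L , |L|≡s , independent , _) = begin-strict
      s * suc b ^ suc n          ≤⟨ *-monoˡ-≤ (suc b ^ suc n) (s≤qⁿ L |L|≡s independent) ⟩
      q ^ suc n * suc b ^ suc n  ≡⟨ ^-distribʳ-* q (suc b) (suc n) ⟨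
      (q * suc b) ^ suc n        <⟨ ^-monoˡ-< (suc n) q[1+b]<a ⟩
      a ^ suc n                  ∎

theorem7p13 : {c ℓ : Level} (F : Field c ℓ) (q : ℕ) (T : Tensor F q)
    → LowerTriangular F q T
    → (AsymptoticIndependenceEq F T q ⇔ QDiagonalDistinctZ F q T)
theorem7p13 F q T lowerTriangular = mk⇔ forward backward
  where
  open Triangular F T lowerTriangular using (diagonal-term; QDiagonalDistinctZ-intro)
  forward : AsymptoticIndependenceEq F T q → QDiagonalDistinctZ F q T
  forward (lower , _) = QDiagonalDistinctZ-intro (proj₁ ∘ diagonal-term lower) (proj₂ ∘ diagonal-term lower)
    (diagonal-z-distinct F T lowerTriangular lower)
  backward : QDiagonalDistinctZ F q T → AsymptoticIndependenceEq F T q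
  backward qDiagonal with z , zT , z-injective ← diagonal-choice F T lowerTriangular qDiagonal =
    limsup≥q F T lowerTriangular z zT z-injective , limsup≤q F T
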